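{- Let $R$ be an EPRF-TRS and $S$ be a TRS over a ranked alphabet $\Sigma$. Let $g\in\Sigma-(sign(R)\cup\Sigma_0)$ and let $\sharp\in\Sigma_0$ be irreducible for $R$. Then it is decidable whether $\Rightarrow^*_S\cap(T_\Sigma\times T_\Sigma)\subseteq\Rightarrow^*_R\cap(T_\Sigma\times T_\Sigma)$.
   Context: A ranked alphabet $\Sigma$ is a finite set of symbols with ranks, $\Sigma_0$ its constants; $X$ a countable set of variables, $T_\Sigma(X)$ the terms, $T_\Sigma$ the ground terms. A TRS $R$ over $\Sigma$ is a finite set of rules $l\to r$, $l,r\in T_\Sigma(X)$, with every variable of $r$ occurring in $l$; $\Rightarrow^*_R$ is the reflexive transitive closure of its rewrite relation; $sign(R)$ is the set of symbols in its rules; a term is irreducible for $R$ if no rule of $R$ applies to it. $R^*_\Gamma(L)=\{p\mid q\Rightarrow^*_R p,\ q\in L\}$. A bottom-up tree automaton (bta) over $\Gamma$ is a finite automaton with states (treated as constants), final states, rules $\delta(a_1,\dots,a_n)\to a$ and $a\to a'$, recognizing the ground terms rewriting to a final state. $R$ is an EPRF-TRS if for any given ranked alphabet $\Gamma\supseteq sign(R)$ and finite $L\subseteq T_\Gamma$ one can effectively construct a bta $\mathcal{C}$ over $\Gamma$ with $L(\mathcal{C})=R^*_\Gamma(L)$. -}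

module Defs where

open import Data.Nat using (ℕ)
open import Data.Fin using (Fin)
open import Data.Empty using (⊥)
open import Data.Product using (Σ; ∃; _×_; _,_; proj₁; proj₂)
open import Data.Sum using (_⊎_)
open import Data.List using (List)
open import Data.List.Membership.Propositional using (_∈_)
open import Data.List.Relation.Unary.All using (All)
open import Data.List.Relation.Unary.Any using (Any)
open import Data.Vec using (Vec; []; _∷_; lookup; _[_]≔_)
open import Data.Vec.Relation.Binary.Pointwise.Inductive using (Pointwise)
open import Relation.Nullary using (¬_)
open import Relation.Binary.Construct.Closure.ReflexiveTransitive using (Star)

-- A ranked symbol: (name , rank).  A ranked alphabet is a finite list of symbols.
Sym : Set
Sym = ℕ × ℕ

arity : Sym → ℕ
arity = proj₂

Alphabet : Set
Alphabet = List Sym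

-- Terms over variables V (V = ℕ : the countable variable set X; V = ⊥ : ground terms)
data Term (V : Set) : Set where
  var : V → Term V
  app : (f : Sym) → Vec (Term V) (arity f) → Term V

GTerm : Set
GTerm = Term ⊥

mutual
  subst : ∀ {V : Set} → (V → GTerm) → Term V → GTerm
  subst σ (var x) = σ x
  subst σ (app f ts) = app f (substs σ ts)

  substs : ∀ {V : Set} {n} → (V → GTerm) → Vec (Term V) n → Vec GTerm n
  substs σ [] = []
  substs σ (t ∷ ts) = subst σ t ∷ substs σ ts

data OccSym {V : Set} (f : Sym) : Term V → Set where
  here  : ∀ ts → OccSym f (app f ts)
  there : ∀ {h ts} (i : Fin (arity h)) → OccSym f (lookup ts i) → OccSym f (app h ts)

data OccVar {V : Set} (x : V) : Term V → Set where
  here  : OccVar x (var x)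
  there : ∀ {h ts} (i : Fin (arity h)) → OccVar x (lookup ts i) → OccVar x (app h ts)

Over : ∀ {V : Set} → Alphabet → Term V → Set
Over Γ t = ∀ f → OccSym f t → f ∈ Γ

Rule : Set
Rule = Term ℕ × Term ℕ

record TRS : Set where
  constructor mkTRS
  field
    rules   : List Rule
    varCond : All (λ lr → ∀ x → OccVar x (proj₂ lr) → OccVar x (proj₁ lr)) rules
open TRS public

InSign : TRS → Sym → Set
InSign R f = Any (λ lr → OccSym f (proj₁ lr) ⊎ OccSym f (proj₂ lr)) (rules R)

TRSOver : Alphabet → TRS → Set
TRSOver Sig R = ∀ f → InSign R f → f ∈ Sig

data Step (R : TRS) : GTerm → GTerm → Set where
  root : ∀ {l r} → (l , r) ∈ rules R → (σ : ℕ → GTerm) → Step R (subst σ l) (subst σ r)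
  cong : ∀ {f ts} (i : Fin (arity f)) {t'} → Step R (lookup ts i) t' →
         Step R (app f ts) (app f (ts [ i ]≔ t'))

Steps : TRS → GTerm → GTerm → Set
Steps R = Star (Step R)

Irreducible : TRS → GTerm → Set
Irreducible R t = ∀ t' → ¬ Step R t t'

record BTA (Γ : Alphabet) : Set where
  field
    nStates   : ℕ
    final     : List (Fin nStates)
    delta     : List (Σ Sym λ f → Vec (Fin nStates) (arity f) × Fin nStates)
    deltaOver : All (λ d → proj₁ d ∈ Γ) delta
    eps       : List (Fin nStates × Fin nStates)

-- Runs C t q : t ⇒* q in the automaton C (states regarded as constants)
data Runs {Γ : Alphabet} (C : BTA Γ) : GTerm → Fin (BTA.nStates C) → Set where
  rule : ∀ {f ts qs q} → (f , qs , q) ∈ BTA.delta C → Pointwise (Runs C) ts qs →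
         Runs C (app f ts) q
  epsR : ∀ {t q q'} → Runs C t q → (q , q') ∈ BTA.eps C → Runs C t q'

Lang : ∀ {Γ} → BTA Γ → GTerm → Set
Lang {Γ} C t = Over Γ t × ∃ λ q → q ∈ BTA.final C × Runs C t q

Descendants : TRS → List GTerm → GTerm → Set
Descendants R L p = ∃ λ q → q ∈ L × Steps R q p

-- EPRF-TRS: an effective construction (a function) of a bta for R^*_Γ(L)
EPRF : TRS → Set
EPRF R = (Γ : Alphabet) → (∀ f → InSign R f → f ∈ Γ) →
         (L : List GTerm) → All (Over Γ) L →
         Σ (BTA Γ) λ C → ∀ t → (Lang C t → Descendants R L t) × (Descendants R L t → Lang C t)

-- For a rule l → r of S let l̂, r̂ be l, r with each variable x replaced by a fresh constant
-- c_x ∉ Σ.  The inclusion holds iff l̂ ⇒*_R r̂ for every rule of S: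
--  * if it holds for all rules, instantiating the c_x by arbitrary ground terms preserves
--    R-derivations (R never mentions them), so every S-step is an R-derivation;
--  * conversely, encode c_x inside Σ as a tower of g's over ♯ of height (x + 1)(K + 1),
--    K bounding the nesting of g in l̂, r̂.  The encoded instance of l → r is an S-step,
--    hence an R-derivation; as g ∉ sign(R) and ♯ is R-irreducible the towers are frozen,
--    so this derivation lifts to one from l̂, whose end point decodes to r̂.
-- Each test l̂ ⇒*_R r̂ is decidable: R^*({l̂}) is recognised by a bta, and bta membership is
-- decidable (runs in normal form, plus Floyd–Warshall reachability along ε-rules).
module Submission where

open import Defs
open import Data.Nat using (ℕ; zero; suc; _+_; _*_; _∸_; _⊔_; _/_; _≤_; _<_; _≤?_; z≤n; s≤s)
open import Data.Nat.Properties
  using (≤-refl; ≤-reflexive; ≤-trans; <-≤-trans; <-irrefl; ≤∧≢⇒<; ≤-pred; n≤1+n; m≤m+n;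
         m≤m⊔n; m≤n⊔m; m+n∸m≡n; m+[n∸m]≡n; <⇒≱; ≰⇒>; +-monoˡ-≤; +-monoˡ-<; *-monoˡ-≤)
open import Data.Nat.DivMod using (m*n/n≡m)
open import Data.Fin using (Fin; toℕ; fromℕ<) renaming (zero to fzero; suc to fsuc)
open import Data.Fin.Properties using (toℕ<n; toℕ-fromℕ<; toℕ-injective; any?) renaming (_≟_ to _≟F_)
open import Data.Empty using (⊥; ⊥-elim)
open import Data.Maybe using (Maybe; just; nothing; maybe′)
import Data.Maybe as Maybe
open import Data.Maybe.Properties using (just-injective)
open import Data.Product using (Σ; ∃; ∃₂; _×_; _,_; proj₁; proj₂)
open import Data.Product.Properties using (≡-dec)
open import Data.Sum using (_⊎_; inj₁; inj₂; [_,_])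
open import Data.List using (List; []; _∷_; _++_)
import Data.List as List
open import Data.List.Extrema.Nat using (max; xs≤max)
open import Data.List.Membership.Propositional using (_∈_; lose; find)
open import Data.List.Membership.Propositional.Properties using (∈-++⁺ˡ; ∈-++⁺ʳ; ∈-map⁺)
open import Data.List.Membership.DecPropositional using () renaming (_∈?_ to member?)
open import Data.List.Relation.Unary.Any as Any using (Any; here; there)
import Data.List.Relation.Unary.All as ListAll
open import Data.Vec using (Vec; []; _∷_; lookup; _[_]≔_; replicate)
open import Data.Vec.Properties using (lookup∘update; []≔-idempotent; []≔-lookup; lookup-replicate)
open import Data.Vec.Relation.Unary.All using ([]; _∷_) renaming (All to AllV)
open import Data.Vec.Relation.Unary.All.Properties using (lookup⁺)
open import Data.Vec.Relation.Binary.Pointwise.Inductive using (Pointwise; []; _∷_)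
open import Relation.Nullary using (¬_; Dec; yes; no)
open import Relation.Nullary.Decidable using (map′; _×-dec_; _⊎-dec_)
import Relation.Binary.PropositionalEquality as ≡
open ≡ using (_≡_; _≢_; refl; sym; trans; cong₂)
open import Relation.Binary.Construct.Closure.ReflexiveTransitive using (Star; ε; _◅_; _◅◅_; gmap; kleisliStar)
open import Function using (id)

_≟S_ : (f f' : Sym) → Dec (f ≡ f')
_≟S_ = ≡-dec Data.Nat._≟_ Data.Nat._≟_

all∈? : ∀ {A : Set} {P : A → Set} (xs : List A) →
        (∀ {x} → x ∈ xs → Dec (P x)) → Dec (∀ {x} → x ∈ xs → P x)
all∈? [] P? = yes λ ()
all∈? (x ∷ xs) P? with P? (here refl) | all∈? xs (λ m → P? (there m))
... | yes p  | yes ps = yes λ { (here refl) → p ; (there m) → ps m }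
... | no ¬p  | _      = no λ ps → ¬p (ps (here refl))
... | _      | no ¬ps = no λ ps → ¬ps (λ m → ps (there m))

step-under : ∀ {R f} (ts : Vec GTerm (arity f)) (i : Fin (arity f)) {a b} →
             Step R a b → Step R (app f (ts [ i ]≔ a)) (app f (ts [ i ]≔ b))
step-under {f = f} ts i {a} {b} s =
  ≡.subst (λ us → Step _ (app f (ts [ i ]≔ a)) (app f us)) ([]≔-idempotent ts i)
    (cong i (≡.subst (λ z → Step _ z b) (sym (lookup∘update i ts a)) s))

steps-under : ∀ {R f} (ts : Vec GTerm (arity f)) (i : Fin (arity f)) {a b} →
              Steps R a b → Steps R (app f (ts [ i ]≔ a)) (app f (ts [ i ]≔ b))
steps-under {f = f} ts i = gmap (λ z → app f (ts [ i ]≔ z)) (step-under ts i)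

app-injective : ∀ {V : Set} {f f' : Sym} {xs : Vec (Term V) (arity f)} {ys : Vec (Term V) (arity f')} →
                app f xs ≡ app f' ys → Σ (f ≡ f') λ { refl → xs ≡ ys }
app-injective refl = refl , refl

lookup-substs : ∀ {V : Set} {n} (ρ : V → GTerm) (ts : Vec (Term V) n) (i : Fin n) →
                lookup (substs ρ ts) i ≡ subst ρ (lookup ts i)
lookup-substs ρ (t ∷ ts) fzero    = refl
lookup-substs ρ (t ∷ ts) (fsuc i) = lookup-substs ρ ts i

mutual
  subst-cong : ∀ {V : Set} (ρ ρ' : V → GTerm) (t : Term V) →
               (∀ y → OccVar y t → ρ y ≡ ρ' y) → subst ρ t ≡ subst ρ' t
  subst-cong ρ ρ' (var x) agree    = agree x here
  subst-cong ρ ρ' (app f ts) agree = ≡.cong (app f) (substs-cong ρ ρ' ts (λ i y o → agree y (there i o)))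

  substs-cong : ∀ {V : Set} {n} (ρ ρ' : V → GTerm) (ts : Vec (Term V) n) →
                (∀ i y → OccVar y (lookup ts i) → ρ y ≡ ρ' y) → substs ρ ts ≡ substs ρ' ts
  substs-cong ρ ρ' [] agree       = refl
  substs-cong ρ ρ' (t ∷ ts) agree =
    cong₂ _∷_ (subst-cong ρ ρ' t (agree fzero)) (substs-cong ρ ρ' ts (λ i → agree (fsuc i)))

mutual
  occ-subst : ∀ {V : Set} {f} (ρ : V → GTerm) (t : Term V) → OccSym f (subst ρ t) →
              OccSym f t ⊎ ∃ λ x → OccVar x t × OccSym f (ρ x)
  occ-subst ρ (var x) o = inj₂ (x , here , o)
  occ-subst ρ (app f ts) (here _) = inj₁ (here ts)
  occ-subst ρ (app f ts) (there i o) with occ-substs ρ ts i o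
  ... | inj₁ o'            = inj₁ (there i o')
  ... | inj₂ (x , ov , o') = inj₂ (x , there i ov , o')

  occ-substs : ∀ {V : Set} {f n} (ρ : V → GTerm) (ts : Vec (Term V) n) (i : Fin n) →
               OccSym f (lookup (substs ρ ts) i) →
               OccSym f (lookup ts i) ⊎ ∃ λ x → OccVar x (lookup ts i) × OccSym f (ρ x)
  occ-substs ρ (t ∷ ts) fzero o    = occ-subst ρ t o
  occ-substs ρ (t ∷ ts) (fsuc i) o = occ-substs ρ ts i o

mutual
  varsOf : Term ℕ → List ℕ
  varsOf (var x)    = x ∷ []
  varsOf (app f ts) = varsOfs ts

  varsOfs : ∀ {n} → Vec (Term ℕ) n → List ℕ
  varsOfs []       = []
  varsOfs (t ∷ ts) = varsOf t ++ varsOfs ts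

mutual
  varsOf-complete : ∀ {x} (t : Term ℕ) → OccVar x t → x ∈ varsOf t
  varsOf-complete (var x) here              = here refl
  varsOf-complete (app f ts) (there i o)    = varsOfs-complete ts i o

  varsOfs-complete : ∀ {x n} (ts : Vec (Term ℕ) n) (i : Fin n) → OccVar x (lookup ts i) → x ∈ varsOfs ts
  varsOfs-complete (t ∷ ts) fzero o    = ∈-++⁺ˡ (varsOf-complete t o)
  varsOfs-complete (t ∷ ts) (fsuc i) o = ∈-++⁺ʳ (varsOf t) (varsOfs-complete ts i o)

mutual
  depth : Term ℕ → ℕ
  depth (var _)    = 0
  depth (app f ts) = suc (depths ts)

  depths : ∀ {n} → Vec (Term ℕ) n → ℕ
  depths []       = 0
  depths (t ∷ ts) = depth t ⊔ depths ts

all-update : ∀ {P : GTerm → Set} {n} {ts : Vec GTerm n} (i : Fin n) {x} →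
             AllV P ts → P x → AllV P (ts [ i ]≔ x)
all-update fzero    (p ∷ ps) q = q ∷ ps
all-update (fsuc i) (p ∷ ps) q = p ∷ all-update i ps q

-- Reachability along a decidable relation on a finite set is decidable (Floyd–Warshall).
-- Path k a b is a nonempty E-path from a to b whose intermediate vertices all have index
-- below k; with k = n these are all nonempty paths, and Path (suc k) arises from Path k
-- by admitting the one new intermediate vertex k.
module Reachability {n : ℕ} (E : Fin n → Fin n → Set) (E? : ∀ a b → Dec (E a b)) where

  data Path (k : ℕ) : Fin n → Fin n → Set where
    edge : ∀ {a b}   → E a b → Path k a b
    via  : ∀ {a b c} → E a c → toℕ c < k → Path k c b → Path k a b

  path-mono : ∀ {k k' a b} → k ≤ k' → Path k a b → Path k' a b
  path-mono le (edge e)       = edge e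
  path-mono le (via e lt p)   = via e (<-≤-trans lt le) (path-mono le p)

  path-join : ∀ {k a b c} → Path k a c → toℕ c < k → Path k c b → Path k a b
  path-join (edge e) lt q      = via e lt q
  path-join (via e lt' p) lt q = via e lt' (path-join p lt q)

  path-split : ∀ {k a b} (c : Fin n) → toℕ c ≡ k → Path (suc k) a b → Path k a b ⊎ (Path k a c × Path k c b)
  path-split c c≡k (edge e) = inj₁ (edge e)
  path-split {k} c c≡k (via {c = d} e lt p) with toℕ d Data.Nat.≟ k | path-split c c≡k p
  ... | yes d≡k | rest with toℕ-injective (trans d≡k (sym c≡k))
  ...   | refl with rest
  ...     | inj₁ q       = inj₂ (edge e , q)
  ...     | inj₂ (_ , q) = inj₂ (edge e , q)
  path-split c c≡k (via e lt p) | no d≢k | inj₁ q         = inj₁ (via e (≤∧≢⇒< (≤-pred lt) d≢k) q)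
  path-split c c≡k (via e lt p) | no d≢k | inj₂ (q₁ , q₂) = inj₂ (via e (≤∧≢⇒< (≤-pred lt) d≢k) q₁ , q₂)

  path? : ∀ k → k ≤ n → ∀ a b → Dec (Path k a b)
  path? zero _ a b with E? a b
  ... | yes e = yes (edge e)
  ... | no ¬e = no λ { (edge e) → ¬e e ; (via _ () _) }
  path? (suc k) k<n a b =
    map′ join (path-split c (toℕ-fromℕ< k<n)) (path? k k≤n a b ⊎-dec (path? k k≤n a c ×-dec path? k k≤n c b))
    where
      c = fromℕ< k<n
      k≤n = ≤-trans (n≤1+n k) k<n
      widen : ∀ {a b} → Path k a b → Path (suc k) a b
      widen = path-mono (n≤1+n k)
      join : Path k a b ⊎ (Path k a c × Path k c b) → Path (suc k) a b
      join (inj₁ p)       = widen p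
      join (inj₂ (p , q)) = path-join (widen p) (s≤s (≤-reflexive (toℕ-fromℕ< k<n))) (widen q)

  path⇒star : ∀ {k a b} → Path k a b → Star E a b
  path⇒star (edge e)     = e ◅ ε
  path⇒star (via e _ p)  = e ◅ path⇒star p

  star⇒path : ∀ {a b} → Star E a b → a ≡ b ⊎ Path n a b
  star⇒path ε = inj₁ refl
  star⇒path (_◅_ {j = c} e s) with star⇒path s
  ... | inj₁ refl = inj₂ (edge e)
  ... | inj₂ p    = inj₂ (via e (toℕ<n c) p)

  star? : ∀ a b → Dec (Star E a b)
  star? a b with a ≟F b | path? n ≤-refl a b
  ... | yes refl | _     = yes ε
  ... | no a≢b   | yes p = yes (path⇒star p)
  ... | no a≢b   | no ¬p = no λ s → [ a≢b , ¬p ] (star⇒path s)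

-- A run to q is, in normal form, one
-- δ-rule at the root (whose argument states the children run to) followed by ε-moves, so
-- it suffices to decide runs of the subterms and reachability along ε.
module Membership {Γ : Alphabet} (C : BTA Γ) where
  open BTA C

  DeltaRule : Set
  DeltaRule = Σ Sym λ f → Vec (Fin nStates) (arity f) × Fin nStates

  Eps : Fin nStates → Fin nStates → Set
  Eps q q' = (q , q') ∈ eps

  data RootRule : GTerm → Fin nStates → DeltaRule → Set where
    rootRule : ∀ {f ts qs q} → Pointwise (Runs C) ts qs → RootRule (app f ts) q (f , qs , q)

  NormalRun : GTerm → Fin nStates → Set
  NormalRun t q = ∃ λ q₀ → Any (RootRule t q₀) delta × Star Eps q₀ q

  run⇒normal : ∀ {t q} → Runs C t q → NormalRun t q
  run⇒normal (rule d∈ pw) = _ , lose d∈ (rootRule pw) , ε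
  run⇒normal (epsR r e) with run⇒normal r
  ... | q₀ , d , s = q₀ , d , (s ◅◅ (e ◅ ε))

  normal⇒run : ∀ {t q} → NormalRun t q → Runs C t q
  normal⇒run (q₀ , d , s) with find d
  ... | _ , d∈ , rootRule pw = follow (rule d∈ pw) s
    where
      follow : ∀ {t a b} → Runs C t a → Star Eps a b → Runs C t b
      follow r ε       = r
      follow r (e ◅ s) = follow (epsR r e) s

  open Reachability Eps (λ q q' → member? (≡-dec _≟F_ _≟F_) (q , q') eps) using (star?)

  mutual
    runs? : ∀ t q → Dec (Runs C t q)
    runs? (app f ts) q =
      map′ normal⇒run run⇒normal (any? λ q₀ → Any.any? (rootRule? f ts q₀) delta ×-dec star? q₀ q)

    rootRule? : ∀ f (ts : Vec GTerm (arity f)) q (d : DeltaRule) → Dec (RootRule (app f ts) q d)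
    rootRule? f ts q (f' , qs , q') with f' ≟S f | q' ≟F q
    ... | no f'≢f  | _       = no λ { (rootRule _) → f'≢f refl }
    ... | yes refl | no q'≢q = no λ { (rootRule _) → q'≢q refl }
    ... | yes refl | yes refl with pointwiseRuns? ts qs
    ...   | yes pw = yes (rootRule pw)
    ...   | no ¬pw = no λ { (rootRule pw) → ¬pw pw }

    pointwiseRuns? : ∀ {k} (ts : Vec GTerm k) (qs : Vec (Fin nStates) k) → Dec (Pointwise (Runs C) ts qs)
    pointwiseRuns? [] [] = yes []
    pointwiseRuns? (t ∷ ts) (q ∷ qs) with runs? t q | pointwiseRuns? ts qs
    ... | yes r | yes rs = yes (r ∷ rs)
    ... | no ¬r | _      = no λ { (r ∷ _) → ¬r r }
    ... | _     | no ¬rs = no λ { (_ ∷ rs) → ¬rs rs }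

  accepts? : ∀ t → Dec (∃ λ q → q ∈ final × Runs C t q)
  accepts? t = map′ (λ a → let (q , q∈ , r) = find a in q , q∈ , r)
                    (λ (q , q∈ , r) → lose q∈ r)
                    (Any.any? (runs? t) final)

-- Fresh constants: for a bound N exceeding every symbol name in use, the constants
-- c_x = (N + x , 0) are new.  Replacing variables by them turns rules into ground terms;
-- conversely `instantiate σ` replaces each c_x by σ x and, since rules avoiding fresh
-- constants are insensitive to them, maps R-derivations to R-derivations.
module FreshConstants (N : ℕ) where

  cst : ℕ → GTerm
  cst x = app (N + x , 0) []

  freshIndex : Sym → Maybe ℕ
  freshIndex (a , zero) with N ≤? a
  ... | yes _ = just (a ∸ N)
  ... | no _  = nothing
  freshIndex (a , suc _) = nothing

  freshIndex-cst : ∀ x → freshIndex (N + x , 0) ≡ just x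
  freshIndex-cst x with N ≤? N + x
  ... | yes _ = ≡.cong just (m+n∸m≡n N x)
  ... | no ¬p = ⊥-elim (¬p (m≤m+n N x))

  freshIndex-old : ∀ f → proj₁ f < N → freshIndex f ≡ nothing
  freshIndex-old (a , zero) a<N with N ≤? a
  ... | yes N≤a = ⊥-elim (<⇒≱ a<N N≤a)
  ... | no _    = refl
  freshIndex-old (a , suc _) _ = refl

  freshIndex-just : ∀ f x → freshIndex f ≡ just x → f ≡ (N + x , 0)
  freshIndex-just (a , zero) x eq with N ≤? a
  freshIndex-just (a , zero) x refl | yes N≤a = ≡.cong (_, 0) (sym (m+[n∸m]≡n N≤a))
  freshIndex-just (a , zero) x ()   | no _
  freshIndex-just (a , suc _) x ()

  AvoidsFresh : ∀ {V : Set} → Term V → Set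
  AvoidsFresh t = ∀ f → OccSym f t → freshIndex f ≡ nothing

  RulesAvoidFresh : TRS → Set
  RulesAvoidFresh R = ∀ {l r} → (l , r) ∈ rules R → AvoidsFresh l × AvoidsFresh r

  mutual
    instantiate : (ℕ → GTerm) → GTerm → GTerm
    instantiate σ (app f ts) = maybe′ σ (app f (instantiates σ ts)) (freshIndex f)

    instantiates : ∀ {n} → (ℕ → GTerm) → Vec GTerm n → Vec GTerm n
    instantiates σ []       = []
    instantiates σ (t ∷ ts) = instantiate σ t ∷ instantiates σ ts

  instantiate-old : ∀ σ f ts → freshIndex f ≡ nothing → instantiate σ (app f ts) ≡ app f (instantiates σ ts)
  instantiate-old σ f ts eq rewrite eq = refl

  lookup-instantiates : ∀ {n} σ (ts : Vec GTerm n) i → lookup (instantiates σ ts) i ≡ instantiate σ (lookup ts i)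
  lookup-instantiates σ (t ∷ ts) fzero    = refl
  lookup-instantiates σ (t ∷ ts) (fsuc i) = lookup-instantiates σ ts i

  instantiates-update : ∀ {n} σ (ts : Vec GTerm n) i t →
                        instantiates σ (ts [ i ]≔ t) ≡ instantiates σ ts [ i ]≔ instantiate σ t
  instantiates-update σ (_ ∷ ts) fzero t    = refl
  instantiates-update σ (u ∷ ts) (fsuc i) t = ≡.cong (instantiate σ u ∷_) (instantiates-update σ ts i t)

  mutual
    instantiate-subst : ∀ σ ρ (t : Term ℕ) → AvoidsFresh t →
                        instantiate σ (subst ρ t) ≡ subst (λ x → instantiate σ (ρ x)) t
    instantiate-subst σ ρ (var x) av    = refl
    instantiate-subst σ ρ (app f ts) av =
      trans (instantiate-old σ f (substs ρ ts) (av f (here ts)))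
            (≡.cong (app f) (instantiate-substs σ ρ ts (λ i g o → av g (there i o))))

    instantiate-substs : ∀ {n} σ ρ (ts : Vec (Term ℕ) n) → (∀ i → AvoidsFresh (lookup ts i)) →
                         instantiates σ (substs ρ ts) ≡ substs (λ x → instantiate σ (ρ x)) ts
    instantiate-substs σ ρ [] av       = refl
    instantiate-substs σ ρ (t ∷ ts) av =
      cong₂ _∷_ (instantiate-subst σ ρ t (av fzero)) (instantiate-substs σ ρ ts (λ i → av (fsuc i)))

  instantiate-cst : ∀ σ (t : Term ℕ) → AvoidsFresh t → instantiate σ (subst cst t) ≡ subst σ t
  instantiate-cst σ t av = trans (instantiate-subst σ cst t av)
    (subst-cong _ σ t (λ y _ → ≡.cong (maybe′ σ _) (freshIndex-cst y)))

  instantiate-step : ∀ {R} σ → RulesAvoidFresh R → ∀ {u v} → Step R u v → Step R (instantiate σ u) (instantiate σ v)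
  instantiate-step σ av (root {l} {r} lr ρ)
    rewrite instantiate-subst σ ρ l (proj₁ (av lr)) | instantiate-subst σ ρ r (proj₂ (av lr)) = root lr _
  instantiate-step σ av (cong {f = (a , zero)} () s)
  instantiate-step σ av (cong {f = (a , suc b)} {ts} i {t'} s) =
    ≡.subst (λ us → Step _ (app (a , suc b) (instantiates σ ts)) (app (a , suc b) us))
            (sym (instantiates-update σ ts i t'))
            (cong i (≡.subst (λ z → Step _ z (instantiate σ t')) (sym (lookup-instantiates σ ts i))
                             (instantiate-step σ av s)))

  instantiate-steps : ∀ {R} σ → RulesAvoidFresh R → ∀ {u v} → Steps R u v → Steps R (instantiate σ u) (instantiate σ v)
  instantiate-steps σ av = gmap (instantiate σ) (instantiate-step σ av)

  -- Soundness of the rule test: if every rule l → r of S has l̂ ⇒*_R r̂, then every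
  -- S-step is an R-derivation, as the step's instance is an instantiation of l̂ ⇒*_R r̂.
  simulate : ∀ {R S} → RulesAvoidFresh R → RulesAvoidFresh S →
             (∀ {l r} → (l , r) ∈ rules S → Steps R (subst cst l) (subst cst r)) →
             ∀ {u v} → Steps S u v → Steps R u v
  simulate {R} {S} avR avS rulesHold = kleisliStar id simulate-step
    where
      simulate-step : ∀ {u v} → Step S u v → Steps R u v
      simulate-step (root {l} {r} lr σ) =
        ≡.subst₂ (Steps R) (instantiate-cst σ l (proj₁ (avS lr))) (instantiate-cst σ r (proj₂ (avS lr)))
                 (instantiate-steps σ avR (rulesHold lr))
      simulate-step (cong {f} {ts} i {t'} s) =
        ≡.subst (λ us → Steps R (app f us) (app f (ts [ i ]≔ t'))) ([]≔-lookup ts i) (steps-under ts i (simulate-step s))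

-- With g = (gn , 1 + ga),
-- ♯ = (sh , 0) and D = K + 1, the constant c_x is encoded by the tower
-- g(g(…g(♯,♯…)…,♯…),♯…) of height H x = (x + 1)·D.  On terms carrying at most K
-- occurrences of g on each path this encoding has a left inverse `decode`: there, the
-- left g-spine of an encoded subterm has height H x exactly at encoded constants, and
-- otherwise height ≤ K or j + H x with 1 ≤ j ≤ K, neither of which is a multiple of D.
module Towers (N gn ga sh K : ℕ) where
  open FreshConstants N

  g : Sym
  g = (gn , suc ga)

  ♯ : GTerm
  ♯ = app (sh , 0) []

  D : ℕ
  D = suc K

  H : ℕ → ℕ
  H x = suc x * D

  tower : ℕ → GTerm
  tower zero    = ♯
  tower (suc m) = app g (tower m ∷ replicate ga ♯)

  encode : GTerm → GTerm
  encode = instantiate (λ x → tower (H x))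

  encodes : ∀ {n} → Vec GTerm n → Vec GTerm n
  encodes = instantiates (λ x → tower (H x))

  -- the length of the leftmost g-spine of a term, if that spine ends in a constant
  spine : GTerm → Maybe ℕ
  spine (app (a , zero) _) = just 0
  spine (app (a , suc b) (t ∷ _)) with (a , suc b) ≟S g
  ... | yes _ = Maybe.map suc (spine t)
  ... | no _  = nothing

  spine-g : ∀ t ts → spine (app g (t ∷ ts)) ≡ Maybe.map suc (spine t)
  spine-g t ts with g ≟S g
  ... | yes _ = refl
  ... | no g≢g = ⊥-elim (g≢g refl)

  spine-head : ∀ f ts {m} → spine (app f ts) ≡ just (suc m) → f ≡ g
  spine-head (a , zero) ts ()
  spine-head (a , suc b) (t ∷ _) eq with (a , suc b) ≟S g
  ... | yes f≡g = f≡g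
  ... | no _ with eq
  ...   | ()

  spine-g-inv : ∀ t ts {m} → spine (app g (t ∷ ts)) ≡ just (suc m) → spine t ≡ just m
  spine-g-inv t ts eq with spine t | trans (sym (spine-g t ts)) eq
  ... | just m' | eq' = ≡.cong just (≡.cong Data.Nat.pred (just-injective eq'))
  ... | nothing | ()

  spine-tower : ∀ m → spine (tower m) ≡ just m
  spine-tower zero    = refl
  spine-tower (suc m) = trans (spine-g (tower m) (replicate ga ♯)) (≡.cong (Maybe.map suc) (spine-tower m))

  -- the x with H x = m, if there is one
  code : ℕ → Maybe ℕ
  code m with H (m / D ∸ 1) Data.Nat.≟ m
  ... | yes _ = just (m / D ∸ 1)
  ... | no _  = nothing

  code-H : ∀ x → code (H x) ≡ just x
  code-H x with H (H x / D ∸ 1) Data.Nat.≟ H x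
  ... | yes _ = ≡.cong (λ q → just (q ∸ 1)) (m*n/n≡m (suc x) D)
  ... | no ne = ⊥-elim (ne (≡.cong (λ q → H (q ∸ 1)) (m*n/n≡m (suc x) D)))

  code-sound : ∀ m y → code m ≡ just y → H y ≡ m
  code-sound m y eq with H (m / D ∸ 1) Data.Nat.≟ m
  code-sound m y refl | yes H≡m = H≡m
  code-sound m y ()   | no _

  -- x if the term is (up to its other arguments) the tower encoding c_x
  towerIndex : GTerm → Maybe ℕ
  towerIndex t = Maybe._>>=_ (spine t) code

  towerIndex-sound : ∀ t y → towerIndex t ≡ just y → spine t ≡ just (H y)
  towerIndex-sound t y eq with spine t
  ... | just m  = ≡.cong just (sym (code-sound m y eq))
  ... | nothing with eq
  ...   | ()

  towerIndex-tower : ∀ x → towerIndex (tower (H x)) ≡ just x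
  towerIndex-tower x = trans (≡.cong (λ s → Maybe._>>=_ s code) (spine-tower (H x))) (code-H x)

  towerIndex-non-g : ∀ f ts → f ≢ g → towerIndex (app f ts) ≡ nothing
  towerIndex-non-g f ts f≢g with towerIndex (app f ts) in eq
  ... | nothing = refl
  ... | just y  = ⊥-elim (f≢g (spine-head f ts (towerIndex-sound (app f ts) y eq)))

  mutual
    decode : GTerm → GTerm
    decode (app f ts) = maybe′ cst (app f (decodes ts)) (towerIndex (app f ts))

    decodes : ∀ {n} → Vec GTerm n → Vec GTerm n
    decodes []       = []
    decodes (t ∷ ts) = decode t ∷ decodes ts

  tower-over : ∀ {Γ} → g ∈ Γ → (sh , 0) ∈ Γ → ∀ m → Over Γ (tower m)
  tower-over g∈ ♯∈ zero    _ (here _)          = ♯∈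
  tower-over g∈ ♯∈ (suc m) _ (here _)          = g∈
  tower-over g∈ ♯∈ (suc m) f (there fzero o)   = tower-over g∈ ♯∈ m f o
  tower-over g∈ ♯∈ (suc m) f (there (fsuc j) o) with ≡.subst (OccSym f) (lookup-replicate j ♯) o
  ... | here _ = ♯∈

  data BoundedG : ℕ → GTerm → Set where
    g-node     : ∀ {k ts} → AllV (BoundedG k) ts → BoundedG (suc k) (app g ts)
    other-node : ∀ {k f ts} → f ≢ g → AllV (BoundedG k) ts → BoundedG k (app f ts)

  mutual
    boundedG-mono : ∀ {k k' t} → k ≤ k' → BoundedG k t → BoundedG k' t
    boundedG-mono (s≤s le) (g-node bs)     = g-node (boundedGs-mono le bs)
    boundedG-mono le (other-node f≢g bs)   = other-node f≢g (boundedGs-mono le bs)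

    boundedGs-mono : ∀ {k k' n} {ts : Vec GTerm n} → k ≤ k' → AllV (BoundedG k) ts → AllV (BoundedG k') ts
    boundedGs-mono le []       = []
    boundedGs-mono le (b ∷ bs) = boundedG-mono le b ∷ boundedGs-mono le bs

  -- H y is never j + H x for 0 < j ≤ K: consecutive codes are D = K + 1 apart
  code-gap : ∀ x y j → 1 ≤ j → j ≤ K → H y ≢ j + H x
  code-gap x y j 1≤j j≤K Hy≡ with y ≤? x
  ... | yes y≤x = <⇒≱ (≤-trans (+-monoˡ-≤ (H x) 1≤j) (≤-reflexive (sym Hy≡))) (*-monoˡ-≤ D (s≤s y≤x))
  ... | no y≰x  = <-irrefl (sym Hy≡) (≤-trans (+-monoˡ-< (H x) (s≤s j≤K)) (*-monoˡ-≤ D (s≤s (≰⇒> y≰x))))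

  -- the spine heights of an encoded term at positions that are not encoded constants
  InnerHeight : ℕ → ℕ → Set
  InnerHeight k m = m ≤ k ⊎ ∃₂ λ x j → 1 ≤ j × j ≤ k × m ≡ j + H x

  inner-height-no-code : ∀ {m} → InnerHeight K m → ∀ y → H y ≢ m
  inner-height-no-code (inj₁ m≤K) y refl = <-irrefl refl (≤-trans (s≤s m≤K) (m≤m+n D (y * D)))
  inner-height-no-code (inj₂ (x , j , 1≤j , j≤K , refl)) y = code-gap x y j 1≤j j≤K

  mutual
    spine-encode : ∀ {k u m} → BoundedG k u → spine (encode u) ≡ just m → (∃ λ x → m ≡ H x) ⊎ InnerHeight k m
    spine-encode {u = app f ts} bg eq with freshIndex f
    ... | just x  = inj₁ (x , just-injective (trans (sym eq) (spine-tower (H x))))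
    ... | nothing = inj₂ (spine-encode-old bg eq)

    spine-encode-old : ∀ {k f ts m} → BoundedG k (app f ts) → spine (app f (encodes ts)) ≡ just m → InnerHeight k m
    spine-encode-old {m = zero} _ _ = inj₁ z≤n
    spine-encode-old {f = f} {ts} {suc m} bg eq with spine-head f (encodes ts) eq
    spine-encode-old (other-node g≢g _) eq | refl = ⊥-elim (g≢g refl)
    spine-encode-old {ts = t ∷ rest} (g-node (b ∷ _)) eq | refl with spine-encode b (spine-g-inv (encode t) (encodes rest) eq)
    ... | inj₁ (x , refl)                           = inj₂ (x , 1 , s≤s z≤n , s≤s z≤n , refl)
    ... | inj₂ (inj₁ m≤k)                           = inj₁ (s≤s m≤k)
    ... | inj₂ (inj₂ (x , j , 1≤j , j≤k , refl))    = inj₂ (x , suc j , s≤s z≤n , s≤s j≤k , refl)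

  towerIndex-encode-old : ∀ {k f ts} → BoundedG k (app f ts) → k ≤ K → towerIndex (app f (encodes ts)) ≡ nothing
  towerIndex-encode-old {k} {f} {ts} bg k≤K with towerIndex (app f (encodes ts)) in eq
  ... | nothing = refl
  ... | just y  = ⊥-elim (inner-height-no-code (widen (spine-encode-old bg spine≡)) y refl)
    where
      spine≡ = towerIndex-sound (app f (encodes ts)) y eq
      widen : InnerHeight k (H y) → InnerHeight K (H y)
      widen (inj₁ le) = inj₁ (≤-trans le k≤K)
      widen (inj₂ (x , j , 1≤j , j≤k , e)) = inj₂ (x , j , 1≤j , ≤-trans j≤k k≤K , e)

  decode-tower : ∀ x → decode (tower (H x)) ≡ cst x
  decode-tower x = ≡.cong (maybe′ cst _) (towerIndex-tower x)

  mutual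
    decode-encode : ∀ {k u} → BoundedG k u → k ≤ K → decode (encode u) ≡ u
    decode-encode {u = app f ts} bg k≤K with freshIndex f in fresh
    ... | just x with freshIndex-just f x fresh
    ...   | refl with ts
    ...     | [] = decode-tower x
    decode-encode {u = app f ts} bg k≤K | nothing =
      trans (≡.cong (maybe′ cst _) (towerIndex-encode-old bg k≤K)) (≡.cong (app f) (decodes-encodes-args bg k≤K))

    decodes-encodes-args : ∀ {k f ts} → BoundedG k (app f ts) → k ≤ K → decodes (encodes ts) ≡ ts
    decodes-encodes-args (g-node bs) k≤K       = decodes-encodes bs (≤-trans (n≤1+n _) k≤K)
    decodes-encodes-args (other-node _ bs) k≤K = decodes-encodes bs k≤K

    decodes-encodes : ∀ {k n} {ts : Vec GTerm n} → AllV (BoundedG k) ts → k ≤ K → decodes (encodes ts) ≡ ts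
    decodes-encodes [] k≤K       = refl
    decodes-encodes (b ∷ bs) k≤K = cong₂ _∷_ (decode-encode b k≤K) (decodes-encodes bs k≤K)

  head-not-g : ∀ {V : Set} {f} {ts : Vec (Term V) (arity f)} → ¬ OccSym g (app f ts) → f ≢ g
  head-not-g {f = f} {ts} no-g f≡g = no-g (≡.subst (λ h → OccSym h (app f ts)) f≡g (here ts))

  mutual
    decode-subst : ∀ ρ (t : Term ℕ) → ¬ OccSym g t → decode (subst ρ t) ≡ subst (λ x → decode (ρ x)) t
    decode-subst ρ (var x) no-g    = refl
    decode-subst ρ (app f ts) no-g =
      trans (≡.cong (maybe′ cst _) (towerIndex-non-g f (substs ρ ts) (head-not-g no-g)))
            (≡.cong (app f) (decode-substs ρ ts (λ i o → no-g (there i o))))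

    decode-substs : ∀ {n} ρ (ts : Vec (Term ℕ) n) → (∀ i → ¬ OccSym g (lookup ts i)) →
                    decodes (substs ρ ts) ≡ substs (λ x → decode (ρ x)) ts
    decode-substs ρ [] no-g       = refl
    decode-substs ρ (t ∷ ts) no-g = cong₂ _∷_ (decode-subst ρ t (no-g fzero)) (decode-substs ρ ts (λ i → no-g (fsuc i)))

  mutual
    boundedG-subst : ∀ {k} ρ (t : Term ℕ) → ¬ OccSym g t → (∀ y → OccVar y t → BoundedG k (ρ y)) →
                     BoundedG k (subst ρ t)
    boundedG-subst ρ (var x) no-g bρ    = bρ x here
    boundedG-subst ρ (app f ts) no-g bρ =
      other-node (head-not-g no-g) (boundedG-substs ρ ts (λ i o → no-g (there i o)) (λ i y o → bρ y (there i o)))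

    boundedG-substs : ∀ {k n} ρ (ts : Vec (Term ℕ) n) → (∀ i → ¬ OccSym g (lookup ts i)) →
                      (∀ i y → OccVar y (lookup ts i) → BoundedG k (ρ y)) → AllV (BoundedG k) (substs ρ ts)
    boundedG-substs ρ [] no-g bρ       = []
    boundedG-substs ρ (t ∷ ts) no-g bρ =
      boundedG-subst ρ t (no-g fzero) (bρ fzero) ∷ boundedG-substs ρ ts (λ i → no-g (fsuc i)) (λ i → bρ (fsuc i))

  mutual
    boundedG-cst : ∀ (t : Term ℕ) → BoundedG (depth t) (subst cst t)
    boundedG-cst (var x) = other-node (λ ()) []
    boundedG-cst (app f ts) with f ≟S g
    ... | yes refl = g-node (boundedG-csts ts)
    ... | no f≢g   = other-node f≢g (boundedGs-mono (n≤1+n _) (boundedG-csts ts))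

    boundedG-csts : ∀ {n} (ts : Vec (Term ℕ) n) → AllV (BoundedG (depths ts)) (substs cst ts)
    boundedG-csts []       = []
    boundedG-csts (t ∷ ts) =
      boundedG-mono (m≤m⊔n _ _) (boundedG-cst t) ∷ boundedGs-mono (m≤n⊔m (depth t) _) (boundedG-csts ts)

  -- If R does not use g, avoids fresh
  -- constants and cannot rewrite ♯, then towers are R-normal forms, and every R-step
  -- from the encoding of a term u is the encoding of an R-step from u.
  module Lifting (R : TRS) (♯-normal : Irreducible R ♯)
                 (no-g : ∀ {l r} → (l , r) ∈ rules R → ¬ OccSym g l × ¬ OccSym g r)
                 (avR : RulesAvoidFresh R) where

    tower-normal : ∀ m {u v} → Step R u v → u ≡ tower m → ⊥
    tower-normal zero s refl = ♯-normal _ s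
    tower-normal (suc m) (root {var y} lr ρ) _     = ♯-normal _ (root {l = var y} lr (λ _ → ♯))
    tower-normal (suc m) (root {app f ls} lr ρ) eq = head-not-g (proj₁ (no-g lr)) (proj₁ (app-injective eq))
    tower-normal (suc m) (cong fzero s) refl       = tower-normal m s refl
    tower-normal (suc m) (cong (fsuc j) s) refl    =
      ♯-normal _ (≡.subst (λ z → Step R z _) (lookup-replicate j ♯) s)

    match-encoding : ∀ ρ (t : Term ℕ) → ¬ OccSym g t → ∀ {k u} → BoundedG k u → k ≤ K →
                     encode u ≡ subst ρ t → ∀ {y} → OccVar y t →
                     encode (decode (ρ y)) ≡ ρ y × BoundedG k (decode (ρ y))
    match-encoding ρ (var y) _ {k} {u} bg k≤K eq here =
      trans (≡.cong encode decode≡u) eq , ≡.subst (BoundedG k) (sym decode≡u) bg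
      where
        decode≡u : decode (ρ y) ≡ u
        decode≡u = trans (≡.cong decode (sym eq)) (decode-encode bg k≤K)
    match-encoding ρ (app f ts) no-g′ (g-node _) k≤K eq (there i o) =
      ⊥-elim (head-not-g no-g′ (sym (proj₁ (app-injective eq))))
    match-encoding ρ (app f ts) no-g′ (other-node {f = f₀} {ts₀} _ bs) k≤K eq (there i o) with freshIndex f₀
    ... | just x  = ⊥-elim (head-not-g no-g′ (sym (proj₁ (app-injective eq))))
    ... | nothing with app-injective eq
    ...   | refl , args≡ =
      match-encoding ρ (lookup ts i) (λ o′ → no-g′ (there i o′)) (lookup⁺ bs i) k≤K arg≡ o
      where
        arg≡ : encode (lookup ts₀ i) ≡ subst ρ (lookup ts i)
        arg≡ = trans (sym (lookup-instantiates _ ts₀ i))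
                     (trans (≡.cong (λ z → lookup z i) args≡) (lookup-substs ρ ts i))

    Lifted : ℕ → GTerm → GTerm → Set
    Lifted k u v = Σ GTerm λ u′ → Step R u u′ × encode u′ ≡ v × BoundedG k u′

    -- a root step from encode u: decoding the matcher of the rule gives the lifted step
    lift-root : ∀ {k u l r} ρ → BoundedG k u → k ≤ K → (l , r) ∈ rules R → encode u ≡ subst ρ l →
                Lifted k u (subst ρ r)
    lift-root {k} {u} {l} {r} ρ bg k≤K lr eq =
      subst ρ₀ r , ≡.subst (λ z → Step R z (subst ρ₀ r)) (sym u≡) (root lr ρ₀) , encode-rhs ,
      boundedG-subst ρ₀ r (proj₂ (no-g lr)) (λ y o → proj₂ (matched (rhs⊆lhs y o)))
      where
        open ≡.≡-Reasoning
        ρ₀ : ℕ → GTerm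
        ρ₀ x = decode (ρ x)
        matched : ∀ {y} → OccVar y l → encode (ρ₀ y) ≡ ρ y × BoundedG k (ρ₀ y)
        matched = match-encoding ρ l (proj₁ (no-g lr)) bg k≤K eq
        rhs⊆lhs : ∀ y → OccVar y r → OccVar y l
        rhs⊆lhs = ListAll.lookup (varCond R) lr
        u≡ : u ≡ subst ρ₀ l
        u≡ = begin
          u                   ≡⟨ sym (decode-encode bg k≤K) ⟩
          decode (encode u)   ≡⟨ ≡.cong decode eq ⟩
          decode (subst ρ l)  ≡⟨ decode-subst ρ l (proj₁ (no-g lr)) ⟩
          subst ρ₀ l          ∎
        encode-rhs : encode (subst ρ₀ r) ≡ subst ρ r
        encode-rhs = begin
          encode (subst ρ₀ r)                ≡⟨ instantiate-subst _ ρ₀ r (proj₂ (avR lr)) ⟩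
          subst (λ x → encode (ρ₀ x)) r      ≡⟨ subst-cong _ ρ r (λ y o → proj₁ (matched (rhs⊆lhs y o))) ⟩
          subst ρ r                          ∎

    encode-update : ∀ f (ts₀ : Vec GTerm (arity f)) i {v₀ v} → freshIndex f ≡ nothing → encode v₀ ≡ v →
                    encode (app f (ts₀ [ i ]≔ v₀)) ≡ app f (encodes ts₀ [ i ]≔ v)
    encode-update f ts₀ i old refl =
      trans (instantiate-old _ f _ old) (≡.cong (app f) (instantiates-update _ ts₀ i _))

    -- steps below the root are lifted in the argument; towers admit none
    lift-step : ∀ {k u w v} → BoundedG k u → k ≤ K → Step R w v → w ≡ encode u → Lifted k u v
    lift-step bg k≤K (root lr ρ) eq = lift-root ρ bg k≤K lr (sym eq)
    lift-step (g-node {k} {ts₀} bs) k≤K (cong i s) refl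
      with lift-step (lookup⁺ bs i) (≤-trans (n≤1+n k) k≤K) s (lookup-instantiates _ ts₀ i)
    ... | v₀ , st , enc≡ , bv = app g (ts₀ [ i ]≔ v₀) , cong i st , encode-update g ts₀ i refl enc≡ ,
                                g-node (all-update i bs bv)
    lift-step (other-node {f = f₀} {ts₀} f₀≢g bs) k≤K (cong i s) eq with freshIndex f₀ in fresh
    ... | just x  = ⊥-elim (tower-normal (H x) (cong i s) eq)
    ... | nothing with app-injective eq
    ...   | refl , refl with lift-step (lookup⁺ bs i) k≤K s (lookup-instantiates _ ts₀ i)
    ...     | v₀ , st , enc≡ , bv = app f₀ (ts₀ [ i ]≔ v₀) , cong i st , encode-update f₀ ts₀ i fresh enc≡ ,
                                    other-node f₀≢g (all-update i bs bv)

    lift-steps : ∀ {u w v} → BoundedG K u → Steps R w v → w ≡ encode u →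
                 Σ GTerm λ u′ → Steps R u u′ × encode u′ ≡ v × BoundedG K u′
    lift-steps {u} bg ε refl = u , ε , refl , bg
    lift-steps bg (s ◅ ss) eq with lift-step bg ≤-refl s eq
    ... | u₁ , st , enc≡ , b₁ with lift-steps b₁ ss (sym enc≡)
    ...   | u′ , sts , enc≡′ , b′ = u′ , st ◅ sts , enc≡′ , b′

Inclusion : Alphabet → TRS → TRS → Set
Inclusion Sig S R = ∀ s t → Over Sig s → Over Sig t → Steps S s t → Steps R s t

module Decision (Sig : Alphabet) (R : TRS) (eprf : EPRF R) (overR : TRSOver Sig R)
                (S : TRS) (overS : TRSOver Sig S)
                (gn ga : ℕ) (g∈ : (gn , suc ga) ∈ Sig) (g∉R : ¬ InSign R (gn , suc ga))
                (sh : ℕ) (♯∈ : (sh , 0) ∈ Sig) (♯-normal : Irreducible R (app (sh , 0) [])) where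

  -- fresh constants are named above every symbol of Σ
  N : ℕ
  N = suc (max 0 (List.map proj₁ Sig))

  open FreshConstants N

  name<N : ∀ {f} → f ∈ Sig → proj₁ f < N
  name<N f∈ = s≤s (ListAll.lookup (xs≤max 0 (List.map proj₁ Sig)) (∈-map⁺ proj₁ f∈))

  avoidsFresh : ∀ T → TRSOver Sig T → RulesAvoidFresh T
  avoidsFresh T overT lr = (λ f o → freshIndex-old f (name<N (overT f (lose lr (inj₁ o)))))
                       , (λ f o → freshIndex-old f (name<N (overT f (lose lr (inj₂ o)))))

  lhs-over : ∀ {l r} → (l , r) ∈ rules S → Over Sig l
  lhs-over lr f o = overS f (lose lr (inj₁ o))

  rhs-over : ∀ {l r} → (l , r) ∈ rules S → Over Sig r
  rhs-over lr f o = overS f (lose lr (inj₂ o))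

  RuleHolds : Rule → Set
  RuleHolds (l , r) = Steps R (subst cst l) (subst cst r)

  Σ⁺ : Term ℕ → Alphabet
  Σ⁺ l = Sig ++ List.map (λ x → (N + x , 0)) (varsOf l)

  cst-over : ∀ l t → Over Sig t → (∀ x → OccVar x t → OccVar x l) → Over (Σ⁺ l) (subst cst t)
  cst-over l t over-t vars⊆ f o with occ-subst cst t o
  ... | inj₁ o′                = ∈-++⁺ˡ (over-t f o′)
  ... | inj₂ (x , ov , here _) = ∈-++⁺ʳ Sig (∈-map⁺ (λ x → (N + x , 0)) (varsOf-complete l (vars⊆ x ov)))

  -- The rule test is decidable: R^*({l̂}) is recognised by a bta over Σ⁺ l.
  ruleHolds? : ∀ {l r} → (l , r) ∈ rules S → Dec (RuleHolds (l , r))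
  ruleHolds? {l} {r} lr with eprf (Σ⁺ l) (λ f f∈R → ∈-++⁺ˡ (overR f f∈R)) (subst cst l ∷ [])
                                  (cst-over l l (lhs-over lr) (λ _ o → o) ListAll.∷ ListAll.[])
  ... | C , correct with Membership.accepts? C (subst cst r)
  ...   | yes acc = yes (derivation (proj₁ (correct (subst cst r)) (r̂-over , acc)))
    where
      r̂-over = cst-over l r (rhs-over lr) (ListAll.lookup (varCond S) lr)
      derivation : Descendants R (subst cst l ∷ []) (subst cst r) → RuleHolds (l , r)
      derivation (_ , here refl , st) = st
  ...   | no ¬acc = no λ st → ¬acc (proj₂ (proj₂ (correct (subst cst r)) (subst cst l , here refl , st)))

  -- The rule test is necessary: apply the inclusion to the instance of l → r in which each
  -- variable x is the tower of height H x, lift the resulting R-derivation back to l̂ and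
  -- decode its end point, which is then r̂.
  ruleHolds-necessary : Inclusion Sig S R → ∀ {l r} → (l , r) ∈ rules S → RuleHolds (l , r)
  ruleHolds-necessary included {l} {r} lr = ≡.subst (Steps R _) u′≡r̂ l̂⇒u′
    where
      open Towers N gn ga sh (depth l ⊔ depth r)
      open Lifting R ♯-normal (λ lr′ → (λ o → g∉R (lose lr′ (inj₁ o))) , (λ o → g∉R (lose lr′ (inj₂ o))))
                   (avoidsFresh R overR)
      open ≡.≡-Reasoning

      τ : ℕ → GTerm
      τ x = tower (H x)

      encoded-instance : Steps R (subst τ l) (subst τ r)
      encoded-instance = included _ _ (over-instance l (lhs-over lr)) (over-instance r (rhs-over lr)) (root lr τ ◅ ε)
        where
          over-instance : ∀ t → Over Sig t → Over Sig (subst τ t)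
          over-instance t over-t f o with occ-subst τ t o
          ... | inj₁ o′            = over-t f o′
          ... | inj₂ (x , _ , o′)  = tower-over g∈ ♯∈ (H x) f o′

      l̂-bounded : BoundedG (depth l ⊔ depth r) (subst cst l)
      l̂-bounded = boundedG-mono (m≤m⊔n _ _) (boundedG-cst l)

      r̂-bounded : BoundedG (depth l ⊔ depth r) (subst cst r)
      r̂-bounded = boundedG-mono (m≤n⊔m (depth l) _) (boundedG-cst r)

      lifted : Σ GTerm λ u′ → Steps R (subst cst l) u′ × encode u′ ≡ subst τ r × BoundedG (depth l ⊔ depth r) u′
      lifted = lift-steps l̂-bounded encoded-instance (sym (instantiate-cst τ l (proj₁ (avoidsFresh S overS lr))))

      u′ : GTerm
      u′ = proj₁ lifted

      l̂⇒u′ : Steps R (subst cst l) u′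
      l̂⇒u′ = proj₁ (proj₂ lifted)

      u′≡r̂ : u′ ≡ subst cst r
      u′≡r̂ = begin
        u′                          ≡⟨ sym (decode-encode (proj₂ (proj₂ (proj₂ lifted))) ≤-refl) ⟩
        decode (encode u′)          ≡⟨ ≡.cong decode (proj₁ (proj₂ (proj₂ lifted))) ⟩
        decode (subst τ r)          ≡⟨ ≡.cong decode (sym (instantiate-cst τ r (proj₂ (avoidsFresh S overS lr)))) ⟩
        decode (encode (subst cst r)) ≡⟨ decode-encode r̂-bounded ≤-refl ⟩
        subst cst r                 ∎

  decideInclusion : Dec (Inclusion Sig S R)
  decideInclusion with all∈? (rules S) ruleHolds?
  ... | yes holds = yes λ _ _ _ _ → simulate (avoidsFresh R overR) (avoidsFresh S overS) holds
  ... | no ¬holds = no λ included → ¬holds (ruleHolds-necessary included)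

mainTheorem18 : (Sig : Alphabet) (R : TRS) → EPRF R → TRSOver Sig R →
    (S : TRS) → TRSOver Sig S →
    (g : Sym) → g ∈ Sig → ¬ InSign R g → arity g ≢ 0 →
    (n : ℕ) → (n , 0) ∈ Sig → Irreducible R (app (n , 0) []) →
    Dec (∀ s t → Over Sig s → Over Sig t → Steps S s t → Steps R s t)
mainTheorem18 Sig R eprf overR S overS (gn , zero) g∈ g∉R g-not-constant n ♯∈ ♯-normal =
  ⊥-elim (g-not-constant refl)
mainTheorem18 Sig R eprf overR S overS (gn , suc ga) g∈ g∉R g-not-constant n ♯∈ ♯-normal =
  Decision.decideInclusion Sig R eprf overR S overS gn ga g∈ g∉R n ♯∈ ♯-normal
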